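{- Let $n\ge 5$. The maximum independence number of an almost self-centered graph of order $n$ is $n-2$, and there are exactly two (up to isomorphism) almost self-centered graphs of order $n$ attaining it.
   Context: All graphs are finite and simple. For a connected graph $G$, the eccentricity of a vertex $v$ is $\max_{u\in V(G)} d(v,u)$; the radius is the minimum eccentricity. A central vertex is one whose eccentricity equals the radius. A connected graph of order $n$ is almost self-centered if it has exactly $n-2$ central vertices. The independence number is the maximum size of a set of pairwise nonadjacent vertices. -}

module Defs where

open import Data.Nat using (ℕ; zero; suc; _≤_; _⊔_; _⊓_; _∸_)
open import Data.Bool using (Bool; true; false; _∧_; _∨_; if_then_else_)
open import Data.Fin using (Fin)
open import Data.Fin.Subset using (Subset; _∈_; ∣_∣)
open import Data.Fin.Permutation using (Permutation′; _⟨$⟩ʳ_)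
open import Data.List using (List; map; foldr; filter; length)
open import Data.Bool.ListAction using (any)
open import Data.List.Base using (allFin)
open import Data.Product using (Σ; _×_; ∃)
open import Relation.Binary.PropositionalEquality using (_≡_)
open import Data.Nat using () renaming (_≟_ to _≟ℕ_)
open import Data.Fin using () renaming (_≟_ to _≟F_)
open import Relation.Nullary.Decidable using (⌊_⌋)

record Graph (n : ℕ) : Set where
  field
    adj    : Fin n → Fin n → Bool
    sym    : ∀ u v → adj u v ≡ adj v u
    irrefl : ∀ u → adj u u ≡ false
open Graph public

module _ {n : ℕ} (G : Graph n) where

  reach : ℕ → Fin n → Fin n → Bool
  reach zero    u v = ⌊ u ≟F v ⌋
  reach (suc k) u v = reach k u v ∨ any (λ w → adj G u w ∧ reach k w v) (allFin n)

  Connected : Set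
  Connected = ∀ u v → ∃ λ k → reach k u v ≡ true

leastFrom : (ℕ → Bool) → ℕ → ℕ → ℕ
leastFrom p zero     k = k
leastFrom p (suc f)  k = if p k then k else leastFrom p f (suc k)

module _ {n : ℕ} (G : Graph n) where

  -- distance: length of a shortest walk (= shortest path); correct for connected G
  dist : Fin n → Fin n → ℕ
  dist u v = leastFrom (λ k → reach G k u v) n 0

  ecc : Fin n → ℕ
  ecc u = foldr _⊔_ 0 (map (dist u) (allFin n))

  radius : ℕ
  radius = foldr _⊓_ n (map ecc (allFin n))

  centralVertices : List (Fin n)
  centralVertices = filter (λ v → ecc v ≟ℕ radius) (allFin n)

  numCentral : ℕ
  numCentral = length centralVertices

  AlmostSelfCentered : Set
  AlmostSelfCentered = Connected G × numCentral ≡ n ∸ 2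

  Independent : Subset n → Set
  Independent S = ∀ i j → i ∈ S → j ∈ S → adj G i j ≡ false

  IndependenceNumber : ℕ → Set
  IndependenceNumber a =
    (Σ (Subset n) λ S → Independent S × ∣ S ∣ ≡ a) ×
    (∀ S → Independent S → ∣ S ∣ ≤ a)

_≅_ : {n : ℕ} → Graph n → Graph n → Set
_≅_ {n} G H = Σ (Permutation′ n) λ σ →
  ∀ u v → adj H (σ ⟨$⟩ʳ u) (σ ⟨$⟩ʳ v) ≡ adj G u v

-- If T is an independent set with at least n − 2 vertices, the at most two vertices x, y outside T
-- form a vertex cover: every other vertex has all its neighbours in {x, y}. Some vertex then reaches
-- everything within two steps, so the radius is at most 2, whereas a vertex adjacent to exactly one
-- of x, y is at distance 3 from a vertex adjacent only to the other one (or from that other one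
-- itself when x ≁ y), hence non-central. Having exactly two non-central vertices then forces G to be
-- H₁ (x ∼ y, one pendant vertex at each of x, y, all others joined to both) or H₂ (x ≁ y, one
-- pendant vertex at x, all others joined to both). Each contains two disjoint edges, so α ≤ n − 2,
-- and they are not isomorphic since H₁ has a triangle while H₂ is bipartite.

module Submission where

open import Defs renaming (sym to adj-sym)
open import Data.Bool using (Bool; true; false; _∧_; _∨_)
open import Data.Bool.ListAction using (any)
open import Data.Empty using (⊥; ⊥-elim)
open import Data.Bool.Properties using (not-injective; ¬-not; ∨-zeroʳ; T-≡)
open import Data.Fin using (Fin; zero; suc)
open import Data.Fin.Properties using (¬∀⟶∃¬; all?; any?) renaming (_≟_ to _≟F_)
open import Data.Fin.Permutation using (Permutation′; _⟨$⟩ʳ_; _⟨$⟩ˡ_; inverseˡ; transpose; _∘ₚ_; id)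
import Data.Fin.Permutation.Components as Components
open import Data.Fin.Subset using (Subset; ∣_∣; ∁; _-_; outside; ⊤) renaming (_∈_ to _∈ₛ_; _∉_ to _∉ₛ_)
open import Data.Fin.Subset.Properties
  using (_∈?_; ∣⊤∣≡n; x∈p⇒∣p-x∣<∣p∣; x∈p∧x≢y⇒x∈p-y; ∣∁p∣≡n∸∣p∣; ∣p∣≤n; x∉p⇒x∈∁p)
open import Data.List using (List; []; _∷_; _++_; length; filter; allFin; foldr; map)
open import Data.Vec using (_∷_)
open import Data.Vec.Base using () renaming (there to thereᵥ)
open import Data.List.Properties using (length-++; length-tabulate; filter-notAll)
open import Data.List.Membership.Propositional using (_∈_; _∉_)
open import Data.List.Membership.Propositional.Properties
  using (∈-filter⁺; ∈-filter⁻; ∈-allFin; ∈-++⁺ˡ; ∈-++⁺ʳ; ∈-map⁺)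
open import Data.List.Relation.Binary.Pointwise using (Pointwise; []; _∷_)
open import Data.List.Relation.Binary.Subset.Propositional using (_⊆_)
open import Data.List.Relation.Unary.All as All using (All; []; _∷_)
import Data.List.Relation.Unary.All.Properties as All
open import Data.List.Relation.Unary.Any as Any using (Any; here; there)
open import Data.List.Relation.Unary.Any.Properties using (any⁺; any⁻)
open import Data.List.Relation.Unary.Unique.Propositional using (Unique; []; _∷_)
import Data.List.Relation.Unary.Unique.Propositional.Properties as Unique
open import Data.Nat using (ℕ; zero; suc; _+_; _≤_; _<_; _∸_; _⊔_; _⊓_; z≤n; s≤s)
open import Data.Nat.Properties
open import Data.Product as Product using (Σ; ∃; ∃₂; _×_; _,_; proj₁; proj₂)
open import Data.Sum using (_⊎_; inj₁; inj₂)
open import Function using (_∘_; Equivalence)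
open import Level using (Level)
open import Relation.Binary.Definitions using (DecidableEquality)
open import Relation.Binary.PropositionalEquality
open import Relation.Nullary using (¬_; Dec; yes; no; ¬?; _×-dec_; contradiction)
open import Relation.Unary using (Pred; Decidable)

open Equivalence using (to; from)

-- Counting

module _ {a : Level} {A : Set a} (_≟_ : DecidableEquality A) where

  unique-⊆⇒length≤ : ∀ {xs ys : List A} → Unique xs → xs ⊆ ys → length xs ≤ length ys
  unique-⊆⇒length≤ {[]}     _              _     = z≤n
  unique-⊆⇒length≤ {x ∷ xs} {ys} (x∉xs ∷ !xs) xs⊆ys = begin-strict
    length xs                        ≤⟨ unique-⊆⇒length≤ !xs xs⊆ys-x ⟩
    length (filter (¬? ∘ (_≟ x)) ys) <⟨ filter-notAll (¬? ∘ (_≟ x)) ys x∈ys ⟩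
    length ys                        ∎
    where
    open ≤-Reasoning
    xs⊆ys-x : xs ⊆ filter (¬? ∘ (_≟ x)) ys
    xs⊆ys-x z∈xs = ∈-filter⁺ (¬? ∘ (_≟ x)) (xs⊆ys (there z∈xs)) (All.lookup x∉xs z∈xs ∘ sym)
    x∈ys : Any (λ z → ¬ z ≢ x) ys
    x∈ys = Any.map (λ x≡z z≢x → z≢x (sym x≡z)) (xs⊆ys (here refl))

module _ {n p} {P : Pred (Fin n) p} (P? : Decidable P) where

  count : ℕ
  count = length (filter P? (allFin n))

  private
    !satisfying : Unique (filter P? (allFin n))
    !satisfying = Unique.filter⁺ P? (Unique.allFin⁺ n)

  count≤length : ∀ {xs} → (∀ i → P i → i ∈ xs) → count ≤ length xs
  count≤length P⊆xs =
    unique-⊆⇒length≤ _≟F_ !satisfying (λ {i} → P⊆xs i ∘ proj₂ ∘ ∈-filter⁻ P? {xs = allFin n})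

  length+count≤n : ∀ {xs} → Unique xs → All (¬_ ∘ P) xs → length xs + count ≤ n
  length+count≤n {xs} !xs ¬Pxs = begin
    length xs + count                   ≡⟨ sym (length-++ xs) ⟩
    length (xs ++ filter P? (allFin n)) ≤⟨ unique-⊆⇒length≤ _≟F_ !xs++satisfying (λ {i} _ → ∈-allFin i) ⟩
    length (allFin n)                   ≡⟨ length-tabulate _ ⟩
    n                                   ∎
    where
    open ≤-Reasoning
    disjoint : ∀ {i} → ¬ (i ∈ xs × i ∈ filter P? (allFin n))
    disjoint (i∈xs , i∈P) = All.lookup ¬Pxs i∈xs (proj₂ (∈-filter⁻ P? {xs = allFin n} i∈P))
    !xs++satisfying : Unique (xs ++ filter P? (allFin n))
    !xs++satisfying = Unique.++⁺ !xs !satisfying disjoint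

  n≤length+count : ∀ {xs} → (∀ i → ¬ P i → i ∈ xs) → n ≤ length xs + count
  n≤length+count {xs} ¬P⊆xs = begin
    n                                   ≡⟨ sym (length-tabulate _) ⟩
    length (allFin n)                   ≤⟨ unique-⊆⇒length≤ _≟F_ (Unique.allFin⁺ n) covered ⟩
    length (xs ++ filter P? (allFin n)) ≡⟨ length-++ xs ⟩
    length xs + count                   ∎
    where
    open ≤-Reasoning
    covered : allFin n ⊆ xs ++ filter P? (allFin n)
    covered {i} _ with P? i
    ... | yes Pi = ∈-++⁺ʳ xs (∈-filter⁺ P? (∈-allFin i) Pi)
    ... | no ¬Pi = ∈-++⁺ˡ (¬P⊆xs i ¬Pi)

  length+count≡n : ∀ {xs} → Unique xs → All (¬_ ∘ P) xs → (∀ i → ¬ P i → i ∈ xs) → length xs + count ≡ n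
  length+count≡n !xs ¬Pxs ¬P⊆xs = ≤-antisym (length+count≤n !xs ¬Pxs) (n≤length+count ¬P⊆xs)

fresh : ∀ {n} (xs : List (Fin n)) → length xs < n → ∃ λ w → w ∉ xs
fresh {n} xs xs<n with all? (λ i → Any.any? (i ≟F_) xs)
... | no  ¬all∈ = ¬∀⟶∃¬ n (_∈ xs) (λ i → Any.any? (i ≟F_) xs) ¬all∈
... | yes all∈  = contradiction n≤length (<⇒≱ xs<n)
  where
  n≤length : n ≤ length xs
  n≤length = ≤-trans (≤-reflexive (sym (length-tabulate _)))
                     (unique-⊆⇒length≤ _≟F_ (Unique.allFin⁺ n) (λ {i} _ → all∈ i))

length≤∣p∣ : ∀ {n} {p : Subset n} {xs} → Unique xs → All (_∈ₛ p) xs → length xs ≤ ∣ p ∣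
length≤∣p∣ {xs = []} _ _ = z≤n
length≤∣p∣ {p = p} {x ∷ xs} (x∉xs ∷ !xs) (x∈p ∷ xs⊆p) =
  ≤-trans (s≤s (length≤∣p∣ !xs xs⊆p-x)) (x∈p⇒∣p-x∣<∣p∣ x∈p)
  where
  xs⊆p-x : All (_∈ₛ p - x) xs
  xs⊆p-x = All.zipWith (λ (z∈p , x≢z) → x∈p∧x≢y⇒x∈p-y z∈p (x≢z ∘ sym)) (xs⊆p , x∉xs)

∣p∣+length≤n : ∀ {n} (p : Subset n) {xs} → Unique xs → All (_∉ₛ p) xs → ∣ p ∣ + length xs ≤ n
∣p∣+length≤n {n} p {xs} !xs xs∉p = begin
  ∣ p ∣ + length xs     ≤⟨ +-monoʳ-≤ ∣ p ∣ (length≤∣p∣ !xs (All.map x∉p⇒x∈∁p xs∉p)) ⟩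
  ∣ p ∣ + ∣ ∁ p ∣       ≡⟨ cong (∣ p ∣ +_) (∣∁p∣≡n∸∣p∣ p) ⟩
  ∣ p ∣ + (n ∸ ∣ p ∣)   ≡⟨ m+[n∸m]≡n (∣p∣≤n p) ⟩
  n                     ∎
  where open ≤-Reasoning

∣p∣+2≤n : ∀ {n} {p : Subset n} {u v} → u ≢ v → u ∉ₛ p → v ∉ₛ p → ∣ p ∣ + 2 ≤ n
∣p∣+2≤n {p = p} u≢v u∉p v∉p = ∣p∣+length≤n p ((u≢v ∷ []) ∷ [] ∷ []) (u∉p ∷ v∉p ∷ [])

-- Permutations

⟨$⟩ʳ-injective : ∀ {n} (σ : Permutation′ n) {u v} → σ ⟨$⟩ʳ u ≡ σ ⟨$⟩ʳ v → u ≡ v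
⟨$⟩ʳ-injective σ {u} {v} eq = trans (sym (inverseˡ σ)) (trans (cong (σ ⟨$⟩ˡ_) eq) (inverseˡ σ))

⟨$⟩ʳ-≢ : ∀ {n} (σ : Permutation′ n) {s z z′} → s ≢ z → σ ⟨$⟩ʳ z ≡ z′ → σ ⟨$⟩ʳ s ≢ z′
⟨$⟩ʳ-≢ σ s≢z σz≡z′ σs≡z′ = s≢z (⟨$⟩ʳ-injective σ (trans σs≡z′ (sym σz≡z′)))

transpose-hit : ∀ {n} (i j : Fin n) → Components.transpose i j i ≡ j
transpose-hit i j with i ≟F i
... | yes _   = refl
... | no i≢i = contradiction refl i≢i

transpose-miss : ∀ {n} {i j k : Fin n} → k ≢ i → k ≢ j → Components.transpose i j k ≡ k
transpose-miss {i = i} {j} {k} k≢i k≢j with k ≟F i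
... | yes k≡i = contradiction k≡i k≢i
... | no _ with k ≟F j
...   | yes k≡j = contradiction k≡j k≢j
...   | no _    = refl

Sends : ∀ {n} → Permutation′ n → List (Fin n) → List (Fin n) → Set
Sends σ = Pointwise (λ u v → σ ⟨$⟩ʳ u ≡ v)

-- After sending the tails, transposing σ x and y leaves the tail images alone: they avoid y because ys is
-- unique, and avoid σ x because xs is.
permutation-sending : ∀ {n} {xs ys : List (Fin n)} → Unique xs → Unique ys → length xs ≡ length ys →
         Σ (Permutation′ n) λ σ → Sends σ xs ys
permutation-sending {xs = []}     {[]}     _            _            _  = id , []
permutation-sending {xs = x ∷ xs} {y ∷ ys} (x∉xs ∷ !xs) (y∉ys ∷ !ys) eq
  with permutation-sending !xs !ys (suc-injective eq)
... | σ , σxs≡ys =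
  σ ∘ₚ transpose (σ ⟨$⟩ʳ x) y , transpose-hit (σ ⟨$⟩ʳ x) y ∷ fixed x∉xs y∉ys σxs≡ys
  where
  fixed : ∀ {us vs} → All (x ≢_) us → All (y ≢_) vs → Sends σ us vs →
          Sends (σ ∘ₚ transpose (σ ⟨$⟩ʳ x) y) us vs
  fixed [] [] [] = []
  fixed (x≢u ∷ x∉) (y≢v ∷ y∉) (refl ∷ σus≡vs) =
    transpose-miss (⟨$⟩ʳ-≢ σ (≢-sym x≢u) refl) (≢-sym y≢v) ∷ fixed x∉ y∉ σus≡vs

-- Walks and eccentricities

any-≡true⁺ : ∀ {a} {A : Set a} (p : A → Bool) {x xs} → x ∈ xs → p x ≡ true → any p xs ≡ true
any-≡true⁺ p x∈xs px = to T-≡ (any⁺ p (Any.map (λ { refl → from T-≡ px }) x∈xs))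

any-≡true⁻ : ∀ {a} {A : Set a} (p : A → Bool) xs → any p xs ≡ true → ∃ λ x → p x ≡ true
any-≡true⁻ p xs h = Product.map₂ (to T-≡) (Any.satisfied (any⁻ p xs (from T-≡ h)))

∧-≡true⁻ : ∀ {a b} → a ∧ b ≡ true → a ≡ true × b ≡ true
∧-≡true⁻ {true} {true} _ = refl , refl

leastFrom-≤ : ∀ (p : ℕ → Bool) fuel {s j} → s ≤ j → p j ≡ true → leastFrom p fuel s ≤ j
leastFrom-≤ p zero       s≤j _  = s≤j
leastFrom-≤ p (suc fuel) {s} s≤j pj with p s in ps
... | true  = s≤j
... | false = leastFrom-≤ p fuel (≤∧≢⇒< s≤j λ { refl → contradiction (trans (sym ps) pj) λ () }) pj

<leastFrom : ∀ (p : ℕ → Bool) fuel {s k} → (∀ i → i ≤ k → p i ≡ false) → k < s + fuel →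
             k < leastFrom p fuel s
<leastFrom p zero       {s} {k} _     k<s = subst (k <_) (+-identityʳ s) k<s
<leastFrom p (suc fuel) {s} {k} ¬p≤k k<s+ with p s in ps | s ≤? k
... | true  | yes s≤k = contradiction (trans (sym ps) (¬p≤k s s≤k)) λ ()
... | true  | no  s≰k = ≰⇒> s≰k
... | false | _       = <leastFrom p fuel ¬p≤k (subst (k <_) (+-suc s fuel) k<s+)

foldr-⊔-lub : ∀ {m} {xs : List ℕ} → All (_≤ m) xs → foldr _⊔_ 0 xs ≤ m
foldr-⊔-lub []         = z≤n
foldr-⊔-lub (x≤m ∷ xs) = ⊔-lub x≤m (foldr-⊔-lub xs)

foldr-⊔-ub : ∀ {x} {xs : List ℕ} → x ∈ xs → x ≤ foldr _⊔_ 0 xs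
foldr-⊔-ub (here refl) = m≤m⊔n _ _
foldr-⊔-ub (there x∈)  = ≤-trans (foldr-⊔-ub x∈) (m≤n⊔m _ _)

foldr-⊓-glb : ∀ {r e} {xs : List ℕ} → r ≤ e → All (r ≤_) xs → r ≤ foldr _⊓_ e xs
foldr-⊓-glb r≤e []         = r≤e
foldr-⊓-glb r≤e (r≤x ∷ xs) = ⊓-glb r≤x (foldr-⊓-glb r≤e xs)

foldr-⊓-lb : ∀ {x e} {xs : List ℕ} → x ∈ xs → foldr _⊓_ e xs ≤ x
foldr-⊓-lb (here refl) = m⊓n≤m _ _
foldr-⊓-lb (there x∈)  = ≤-trans (m⊓n≤n _ _) (foldr-⊓-lb x∈)

module Walks {n : ℕ} (G : Graph n) where

  infixr 5 _∷ʷ_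

  data Walk : ℕ → Fin n → Fin n → Set where
    []ʷ  : ∀ {k u} → Walk k u u
    _∷ʷ_ : ∀ {k u w v} → adj G u w ≡ true → Walk k w v → Walk (suc k) u v

  edge : ∀ {u v} → adj G u v ≡ true → Walk 1 u v
  edge uv = uv ∷ʷ []ʷ

  Walk-mono : ∀ {j k u v} → j ≤ k → Walk j u v → Walk k u v
  Walk-mono _         []ʷ       = []ʷ
  Walk-mono (s≤s j≤k) (uw ∷ʷ p) = uw ∷ʷ Walk-mono j≤k p

  _++ʷ_ : ∀ {j k u w v} → Walk j u w → Walk k w v → Walk (j + k) u v
  _++ʷ_ {j} {k} []ʷ q = Walk-mono (m≤n+m k j) q
  (uw ∷ʷ p) ++ʷ q     = uw ∷ʷ (p ++ʷ q)

  Walk-snoc : ∀ {k u w v} → Walk k u w → adj G w v ≡ true → Walk (suc k) u v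
  Walk-snoc []ʷ       wv = wv ∷ʷ []ʷ
  Walk-snoc (uz ∷ʷ p) wv = uz ∷ʷ Walk-snoc p wv

  Walk-reverse : ∀ {k u v} → Walk k u v → Walk k v u
  Walk-reverse []ʷ       = []ʷ
  Walk-reverse (uw ∷ʷ p) = Walk-snoc (Walk-reverse p) (trans (adj-sym G _ _) uw)

  Walk-closed : (Z : Fin n → Set) → (∀ {u w} → Z u → adj G u w ≡ true → Z w) →
                ∀ {k u v} → Walk k u v → Z u → Z v
  Walk-closed Z closed []ʷ       Zu = Zu
  Walk-closed Z closed (uw ∷ʷ p) Zu = Walk-closed Z closed p (closed Zu uw)

  reach⇒Walk : ∀ k {u v} → reach G k u v ≡ true → Walk k u v
  reach⇒Walk zero {u} {v} h with u ≟F v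
  ... | yes refl = []ʷ
  reach⇒Walk (suc k) {u} {v} h with reach G k u v in uv
  ... | true  = Walk-mono (n≤1+n k) (reach⇒Walk k uv)
  ... | false with any-≡true⁻ _ (allFin n) h
  ...   | w , uw∧wv = let uw , wv = ∧-≡true⁻ uw∧wv in uw ∷ʷ reach⇒Walk k wv

  Walk⇒reach : ∀ {k u v} → Walk k u v → reach G k u v ≡ true
  Walk⇒reach {zero}  {u} []ʷ with u ≟F u
  ... | yes _   = refl
  ... | no u≢u = contradiction refl u≢u
  Walk⇒reach {suc k} {u} {v} []ʷ rewrite Walk⇒reach {k} {u} {v} []ʷ = refl
  Walk⇒reach {suc k} {u} {v} (_∷ʷ_ {w = w} uw p) =
    trans (cong (reach G k u v ∨_) (any-≡true⁺ _ (∈-allFin w) (cong₂ _∧_ uw (Walk⇒reach p)))) (∨-zeroʳ _)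

  dist≤ : ∀ {k u v} → Walk k u v → dist G u v ≤ k
  dist≤ p = leastFrom-≤ _ n z≤n (Walk⇒reach p)

  <dist : ∀ {k u v} → k < n → ¬ Walk k u v → k < dist G u v
  <dist {k} {u} {v} k<n ¬p = <leastFrom _ n unreached k<n
    where
    unreached : ∀ i → i ≤ k → reach G i u v ≡ false
    unreached i i≤k with reach G i u v in r
    ... | false = refl
    ... | true  = contradiction (Walk-mono i≤k (reach⇒Walk i r)) ¬p

  ecc≤ : ∀ {k u} → (∀ v → Walk k u v) → ecc G u ≤ k
  ecc≤ {u = u} p = foldr-⊔-lub (All.map⁺ (All.universal (λ v → dist≤ (p v)) (allFin n)))

  <ecc : ∀ {k u v} → k < n → ¬ Walk k u v → k < ecc G u
  <ecc {u = u} {v} k<n ¬p = <-≤-trans (<dist k<n ¬p) (foldr-⊔-ub (∈-map⁺ (dist G u) (∈-allFin v)))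

  radius≤ecc : ∀ u → radius G ≤ ecc G u
  radius≤ecc u = foldr-⊓-lb (∈-map⁺ (ecc G) (∈-allFin u))

  ≤radius : ∀ {r} → r ≤ n → (∀ u → r ≤ ecc G u) → r ≤ radius G
  ≤radius r≤n r≤ecc = foldr-⊓-glb r≤n (All.map⁺ (All.universal r≤ecc (allFin n)))

  1<ecc : ∀ {u v} → 1 < n → u ≢ v → adj G u v ≡ false → 1 < ecc G u
  1<ecc {u} {v} 1<n u≢v ¬uv = <ecc {v = v} 1<n λ where
    []ʷ         → u≢v refl
    (uv ∷ʷ []ʷ) → contradiction (trans (sym ¬uv) uv) λ ()

  2<ecc : ∀ {u v} → 2 < n → u ≢ v → adj G u v ≡ false →
          (∀ {w} → adj G u w ≡ true → adj G w v ≡ false) → 2 < ecc G u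
  2<ecc {u} {v} 2<n u≢v ¬uv ¬uwv = <ecc {v = v} 2<n λ where
    []ʷ                 → u≢v refl
    (uv ∷ʷ []ʷ)         → contradiction (trans (sym ¬uv) uv) λ ()
    (uw ∷ʷ wv ∷ʷ []ʷ) → contradiction (trans (sym (¬uwv uw)) wv) λ ()

  Connected⇒Walk : Connected G → ∀ u v → ∃ λ k → Walk k u v
  Connected⇒Walk conn u v = Product.map₂ (reach⇒Walk _) (conn u v)

  Walk-isolated : ∀ {u v k} → (∀ w → adj G u w ≡ false) → Walk k u v → u ≡ v
  Walk-isolated {u} ¬u∼ p =
    Walk-closed (u ≡_) (λ { refl uw → contradiction (trans (sym (¬u∼ _)) uw) λ () }) p refl

Central : ∀ {n} → Graph n → Fin n → Set
Central G v = ecc G v ≡ radius G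

central? : ∀ {n} (G : Graph n) → Decidable (Central G)
central? G v = ecc G v ≟ radius G

far⇒noncentral : ∀ {n} (G : Graph n) v → radius G ≤ 2 → 2 < ecc G v → ¬ Central G v
far⇒noncentral G v r≤2 2<e e≡r = <⇒≱ 2<e (≤-trans (≤-reflexive e≡r) r≤2)

record TwoNonCentral {n} (G : Graph n) : Set where
  field
    ¬noncentral₃ : ∀ {a b c} → a ≢ b → a ≢ c → b ≢ c →
                   ¬ Central G a → ¬ Central G b → ¬ Central G c → ⊥
    ¬central⊆    : ∀ {p q} → (∀ v → Central G v → v ≡ p ⊎ v ≡ q) → ⊥
    ¬allCentral  : (∀ v → Central G v) → ⊥

twoNonCentral : ∀ {m} {G : Graph (5 + m)} → numCentral G ≡ 3 + m → TwoNonCentral G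
twoNonCentral {m} {G} central≡ =
  record { ¬noncentral₃ = ¬noncentral₃ ; ¬central⊆ = ¬central⊆ ; ¬allCentral = ¬allCentral }
  where
  ¬noncentral₃ : ∀ {a b c} → a ≢ b → a ≢ c → b ≢ c → ¬ Central G a → ¬ Central G b → ¬ Central G c → ⊥
  ¬noncentral₃ a≢b a≢c b≢c ¬a ¬b ¬c = ≤⇒≯ (subst (λ k → 3 + k ≤ 5 + m) central≡
    (length+count≤n (central? G) ((a≢b ∷ a≢c ∷ []) ∷ (b≢c ∷ []) ∷ [] ∷ []) (¬a ∷ ¬b ∷ ¬c ∷ [])))
    (n<1+n (5 + m))
  ¬central⊆ : ∀ {p q} → (∀ v → Central G v → v ≡ p ⊎ v ≡ q) → ⊥
  ¬central⊆ {p} {q} central⊆ =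
    ≤⇒≯ (subst (_≤ 2) central≡ (count≤length (central? G) {p ∷ q ∷ []} ∈pq)) (s≤s (s≤s (s≤s z≤n)))
    where
    ∈pq : ∀ v → Central G v → v ∈ p ∷ q ∷ []
    ∈pq v c = Data.Sum.[ here , there ∘ here ]′ (central⊆ v c)
  ¬allCentral : (∀ v → Central G v) → ⊥
  ¬allCentral all = ≤⇒≯
    (subst (5 + m ≤_) central≡ (n≤length+count (central? G) {[]} λ v ¬c → contradiction (all v) ¬c))
    (m<n+m (3 + m) {2} (s≤s z≤n))

-- Graphs with a vertex cover of size two

data Place {n} (x y u : Fin n) : Set where
  is-x      : u ≡ x → Place x y u
  is-y      : u ≡ y → Place x y u
  elsewhere : u ≢ x → u ≢ y → Place x y u

place : ∀ {n} (x y u : Fin n) → Place x y u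
place x y u with u ≟F x | u ≟F y
... | yes u≡x | _       = is-x u≡x
... | no _    | yes u≡y = is-y u≡y
... | no u≢x  | no u≢y  = elsewhere u≢x u≢y

VertexCover₂ : ∀ {n} → Graph n → Fin n → Fin n → Set
VertexCover₂ G x y = ∀ {u v} → u ≢ x → u ≢ y → v ≢ x → v ≢ y → adj G u v ≡ false

swap-cover : ∀ {n} {G : Graph n} {x y} → VertexCover₂ G x y → VertexCover₂ G y x
swap-cover cover u≢y u≢x v≢y v≢x = cover u≢x u≢y v≢x v≢y

module Cover {m : ℕ} (G : Graph (5 + m)) {x y : Fin (5 + m)} (cover : VertexCover₂ G x y) where
  open Walks G

  Attached : Set
  Attached = ∀ {s} → s ≢ x → s ≢ y → adj G s x ≡ true ⊎ adj G s y ≡ true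

  Dominates : Fin (5 + m) → Set
  Dominates z = ∀ {s} → s ≢ x → s ≢ y → adj G s z ≡ true

  Misses : Fin (5 + m) → Set
  Misses z = ∃ λ s → s ≢ x × s ≢ y × adj G s z ≡ false

  neighbour∈cover : ∀ {s w} → s ≢ x → s ≢ y → adj G s w ≡ true → w ≡ x ⊎ w ≡ y
  neighbour∈cover {s} {w} s≢x s≢y sw with place x y w
  ... | is-x w≡x          = inj₁ w≡x
  ... | is-y w≡y          = inj₂ w≡y
  ... | elsewhere w≢x w≢y = contradiction (trans (sym (cover s≢x s≢y w≢x w≢y)) sw) λ ()

  connected⇒attached : Connected G → Attached
  connected⇒attached conn {s} s≢x s≢y with adj G s x in sx | adj G s y in sy
  ... | true  | _     = inj₁ refl
  ... | false | true  = inj₂ refl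
  ... | false | false = contradiction (Walk-isolated ¬s∼ (proj₂ (Connected⇒Walk conn s x))) s≢x
    where
    ¬s∼ : ∀ w → adj G s w ≡ false
    ¬s∼ w with adj G s w in sw
    ... | false = refl
    ... | true with neighbour∈cover s≢x s≢y sw
    ...   | inj₁ refl = trans (sym sw) sx
    ...   | inj₂ refl = trans (sym sw) sy

  outsider : ∀ v → ∃ λ w → w ≢ x × w ≢ y × w ≢ v
  outsider v with fresh (x ∷ y ∷ v ∷ []) (s≤s (s≤s (s≤s (s≤s z≤n))))
  ... | w , w∉ = w , w∉ ∘ here , w∉ ∘ there ∘ here , w∉ ∘ there ∘ there ∘ here

  -- The only possible neighbour of s is x, which is not adjacent to t.
  pendant-far : ∀ {s t} → s ≢ x → s ≢ y → adj G s y ≡ false → s ≢ t → adj G s t ≡ false →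
                adj G x t ≡ false → 2 < ecc G s
  pendant-far s≢x s≢y ¬sy s≢t ¬st ¬xt = 2<ecc (s≤s (s≤s (s≤s z≤n))) s≢t ¬st λ sw →
    Data.Sum.[ (λ { refl → ¬xt }) , (λ { refl → contradiction (trans (sym ¬sy) sw) λ () }) ]
      (neighbour∈cover s≢x s≢y sw)

  -- Every neighbour of y lies outside the cover, hence is not adjacent to a.
  hub-far : ∀ {a} → adj G x y ≡ false → a ≢ x → a ≢ y → adj G a y ≡ false → 2 < ecc G y
  hub-far ¬xy a≢x a≢y ¬ay = 2<ecc (s≤s (s≤s (s≤s z≤n))) (≢-sym a≢y) (trans (adj-sym G _ _) ¬ay) λ {w} yw →
    cover (λ { refl → contradiction (trans (sym ¬xy) (trans (adj-sym G _ _) yw)) λ () })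
          (λ { refl → contradiction (trans (sym (irrefl G y)) yw) λ () }) a≢x a≢y

  within₂ : Attached → ∀ {u} → Walk 1 u x → Walk 1 u y → ∀ v → Walk 2 u v
  within₂ attached ux uy v with place x y v
  ... | is-x refl = Walk-mono (n≤1+n 1) ux
  ... | is-y refl = Walk-mono (n≤1+n 1) uy
  ... | elsewhere v≢x v≢y with attached v≢x v≢y
  ...   | inj₁ vx = ux ++ʷ edge (trans (adj-sym G _ _) vx)
  ...   | inj₂ vy = uy ++ʷ edge (trans (adj-sym G _ _) vy)

  within₂′ : Dominates x → Walk 2 x y → ∀ v → Walk 2 x v
  within₂′ x∼ x⇝y v = by-place (place x y v)
    where
    by-place : Place x y v → Walk 2 x v
    by-place (is-x refl)        = []ʷ
    by-place (is-y refl)        = x⇝y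
    by-place (elsewhere v≢x v≢y) = Walk-mono (n≤1+n 1) (edge (trans (adj-sym G _ _) (x∼ v≢x v≢y)))

  ≁y⇒∼x : Attached → ∀ {s} → s ≢ x → s ≢ y → adj G s y ≡ false → adj G s x ≡ true
  ≁y⇒∼x attached s≢x s≢y ¬sy with attached s≢x s≢y
  ... | inj₁ sx = sx
  ... | inj₂ sy = contradiction (trans (sym ¬sy) sy) λ ()

  2≤radius : (∃ λ v → x ≢ v × adj G x v ≡ false) → (∃ λ v → y ≢ v × adj G y v ≡ false) → 2 ≤ radius G
  2≤radius (v , x≢v , ¬xv) (w , y≢w , ¬yw) = ≤radius (s≤s (s≤s z≤n)) 1<ecc′
    where
    1<n : 1 < 5 + m
    1<n = s≤s (s≤s z≤n)
    1<ecc′ : ∀ u → 1 < ecc G u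
    1<ecc′ u = by-place (place x y u)
      where
      by-place : Place x y u → 1 < ecc G u
      by-place (is-x refl) = 1<ecc 1<n x≢v ¬xv
      by-place (is-y refl) = 1<ecc 1<n y≢w ¬yw
      by-place (elsewhere u≢x u≢y) =
        let z , z≢x , z≢y , z≢u = outsider u in 1<ecc 1<n (≢-sym z≢u) (cover u≢x u≢y z≢x z≢y)

module _ {n : ℕ} {G : Graph n} where
  open Walks G

  almostSelfCentered : ∀ {h a b} → a ≢ b → (∀ v → Walk 2 h v) → 2 ≤ radius G → 2 < ecc G a → 2 < ecc G b →
                       (∀ {v} → v ≢ a → v ≢ b → ecc G v ≤ 2) → AlmostSelfCentered G
  almostSelfCentered {h} {a} {b} a≢b hub 2≤r 2<a 2<b ecc≤2 = connected , central≡
    where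
    radius≡2 : radius G ≡ 2
    radius≡2 = ≤-antisym (≤-trans (radius≤ecc h) (ecc≤ hub)) 2≤r
    connected : Connected G
    connected u v = 4 , Walk⇒reach (Walk-reverse (hub u) ++ʷ hub v)
    noncentral⊆ab : ∀ v → ¬ Central G v → v ∈ a ∷ b ∷ []
    noncentral⊆ab v ¬c with place a b v
    ... | is-x v≡a = here v≡a
    ... | is-y v≡b = there (here v≡b)
    ... | elsewhere v≢a v≢b =
      contradiction (≤-antisym (≤-trans (ecc≤2 v≢a v≢b) (≤-reflexive (sym radius≡2))) (radius≤ecc v)) ¬c
    central≡ : numCentral G ≡ n ∸ 2
    central≡ = trans (sym (m+n∸m≡n 2 _)) (cong (_∸ 2)
      (length+count≡n (central? G) ((a≢b ∷ []) ∷ [] ∷ [])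
        (far⇒noncentral G a (≤-reflexive radius≡2) 2<a ∷ far⇒noncentral G b (≤-reflexive radius≡2) 2<b ∷ [])
        noncentral⊆ab))

  endpoint∉ : ∀ {T u v} → Independent G T → adj G u v ≡ true → u ∉ₛ T ⊎ v ∉ₛ T
  endpoint∉ {T} {u} independent uv with u ∈? T
  ... | no u∉T  = inj₁ u∉T
  ... | yes u∈T = inj₂ λ v∈T → contradiction (trans (sym (independent u _ u∈T v∈T)) uv) λ ()

  disjointEdges⇒∣T∣+2≤n : ∀ {T u₁ v₁ u₂ v₂} → Independent G T → adj G u₁ v₁ ≡ true → adj G u₂ v₂ ≡ true →
    u₁ ≢ u₂ → u₁ ≢ v₂ → v₁ ≢ u₂ → v₁ ≢ v₂ → ∣ T ∣ + 2 ≤ n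
  disjointEdges⇒∣T∣+2≤n {T} independent e₁ e₂ ≢₁₁ ≢₁₂ ≢₂₁ ≢₂₂
    with endpoint∉ independent e₁ | endpoint∉ independent e₂
  ... | inj₁ u₁∉ | inj₁ u₂∉ = ∣p∣+2≤n ≢₁₁ u₁∉ u₂∉
  ... | inj₁ u₁∉ | inj₂ v₂∉ = ∣p∣+2≤n ≢₁₂ u₁∉ v₂∉
  ... | inj₂ v₁∉ | inj₁ u₂∉ = ∣p∣+2≤n ≢₂₁ v₁∉ u₂∉
  ... | inj₂ v₁∉ | inj₂ v₂∉ = ∣p∣+2≤n ≢₂₂ v₁∉ v₂∉

coveringPair : ∀ {n} → 2 ≤ n → (xs : List (Fin n)) → Unique xs → length xs ≤ 2 →
               ∃₂ λ x y → x ≢ y × xs ⊆ x ∷ y ∷ []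
coveringPair 2≤n [] _ _ with fresh [] (<⇒≤ 2≤n)
... | x , _ with fresh (x ∷ []) 2≤n
...   | y , y∉ = x , y , (λ x≡y → y∉ (here (sym x≡y))) , λ ()
coveringPair 2≤n (x ∷ []) _ _ with fresh (x ∷ []) 2≤n
... | y , y∉ = x , y , (λ x≡y → y∉ (here (sym x≡y))) , λ { (here u≡x) → here u≡x }
coveringPair _ (x ∷ y ∷ []) ((x≢y ∷ []) ∷ _) _ = x , y , x≢y , λ u∈ → u∈
coveringPair _ (_ ∷ _ ∷ _ ∷ _) _ (s≤s (s≤s ()))

largeIndependent⇒cover : ∀ {n} {G : Graph n} {T} → 2 ≤ n → Independent G T → n ≤ ∣ T ∣ + 2 →
                         ∃₂ λ x y → x ≢ y × VertexCover₂ G x y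
largeIndependent⇒cover {n} {G} {T} 2≤n independent large = toCover (coveringPair 2≤n outsiders !outsiders few)
  where
  outsiders : List (Fin n)
  outsiders = filter (λ u → ¬? (u ∈? T)) (allFin n)
  !outsiders : Unique outsiders
  !outsiders = Unique.filter⁺ _ (Unique.allFin⁺ n)
  few : length outsiders ≤ 2
  few = +-cancelˡ-≤ ∣ T ∣ _ _ (≤-trans (∣p∣+length≤n T !outsiders (All.all-filter _ (allFin n))) large)
  toCover : (∃₂ λ x y → x ≢ y × outsiders ⊆ x ∷ y ∷ []) → ∃₂ λ x y → x ≢ y × VertexCover₂ G x y
  toCover (x , y , x≢y , outsiders⊆xy) =
    x , y , x≢y , λ u≢x u≢y v≢x v≢y → independent _ _ (inside u≢x u≢y) (inside v≢x v≢y)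
    where
    inside : ∀ {u} → u ≢ x → u ≢ y → u ∈ₛ T
    inside {u} u≢x u≢y with u ∈? T
    ... | yes u∈T = u∈T
    ... | no  u∉T with outsiders⊆xy (∈-filter⁺ (λ u → ¬? (u ∈? T)) (∈-allFin u) u∉T)
    ...   | here u≡x         = contradiction u≡x u≢x
    ...   | there (here u≡y) = contradiction u≡y u≢y

cover₂-≅ : ∀ {n} {G H : Graph n} {x y x′ y′} (σ : Permutation′ n) →
  VertexCover₂ G x y → VertexCover₂ H x′ y′ → σ ⟨$⟩ʳ x ≡ x′ → σ ⟨$⟩ʳ y ≡ y′ → adj H x′ y′ ≡ adj G x y →
  (∀ {s} → s ≢ x → s ≢ y → adj H (σ ⟨$⟩ʳ s) x′ ≡ adj G s x × adj H (σ ⟨$⟩ʳ s) y′ ≡ adj G s y) →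
  G ≅ H
cover₂-≅ {G = G} {H} {x} {y} σ coverG coverH refl refl xy profile =
  σ , λ u v → preserves (place x y u) (place x y v)
  where
  flip : ∀ {u v} → adj H (σ ⟨$⟩ʳ v) (σ ⟨$⟩ʳ u) ≡ adj G v u → adj H (σ ⟨$⟩ʳ u) (σ ⟨$⟩ʳ v) ≡ adj G u v
  flip vu = trans (adj-sym H _ _) (trans vu (adj-sym G _ _))
  preserves : ∀ {u v} → Place x y u → Place x y v → adj H (σ ⟨$⟩ʳ u) (σ ⟨$⟩ʳ v) ≡ adj G u v
  preserves (is-x refl)          (is-x refl)          = trans (irrefl H _) (sym (irrefl G _))
  preserves (is-x refl)          (is-y refl)          = xy
  preserves (is-y refl)          (is-x refl)          = flip xy
  preserves (is-y refl)          (is-y refl)          = trans (irrefl H _) (sym (irrefl G _))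
  preserves (elsewhere u≢x u≢y) (is-x refl)          = proj₁ (profile u≢x u≢y)
  preserves (elsewhere u≢x u≢y) (is-y refl)          = proj₂ (profile u≢x u≢y)
  preserves (is-x refl)          (elsewhere v≢x v≢y) = flip (proj₁ (profile v≢x v≢y))
  preserves (is-y refl)          (elsewhere v≢x v≢y) = flip (proj₂ (profile v≢x v≢y))
  preserves (elsewhere u≢x u≢y) (elsewhere v≢x v≢y) =
    trans (coverH (⟨$⟩ʳ-≢ σ u≢x refl) (⟨$⟩ʳ-≢ σ u≢y refl) (⟨$⟩ʳ-≢ σ v≢x refl) (⟨$⟩ʳ-≢ σ v≢y refl))
          (sym (coverG u≢x u≢y v≢x v≢y))

record IsH₁ {n} (G : Graph n) (x y a b : Fin n) : Set where
  field
    x≢y : x ≢ y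
    a≢x : a ≢ x
    a≢y : a ≢ y
    b≢x : b ≢ x
    b≢y : b ≢ y
    a≢b : a ≢ b
    cover : VertexCover₂ G x y
    xy : adj G x y ≡ true
    ax : adj G a x ≡ true
    ay : adj G a y ≡ false
    bx : adj G b x ≡ false
    by : adj G b y ≡ true
    others : ∀ {s} → s ≢ x → s ≢ y → s ≢ a → s ≢ b → adj G s x ≡ true × adj G s y ≡ true

  distinct : Unique (x ∷ y ∷ a ∷ b ∷ [])
  distinct = (x≢y ∷ ≢-sym a≢x ∷ ≢-sym b≢x ∷ []) ∷ (≢-sym a≢y ∷ ≢-sym b≢y ∷ []) ∷ (a≢b ∷ []) ∷ [] ∷ []

record IsH₂ {n} (G : Graph n) (x y a : Fin n) : Set where
  field
    x≢y : x ≢ y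
    a≢x : a ≢ x
    a≢y : a ≢ y
    cover : VertexCover₂ G x y
    xy : adj G x y ≡ false
    ax : adj G a x ≡ true
    ay : adj G a y ≡ false
    others : ∀ {s} → s ≢ x → s ≢ y → s ≢ a → adj G s x ≡ true × adj G s y ≡ true

  distinct : Unique (x ∷ y ∷ a ∷ [])
  distinct = (x≢y ∷ ≢-sym a≢x ∷ []) ∷ (≢-sym a≢y ∷ []) ∷ [] ∷ []

IsH₁-≅ : ∀ {n} {G H : Graph n} {x y a b x′ y′ a′ b′} → IsH₁ G x y a b → IsH₁ H x′ y′ a′ b′ → G ≅ H
IsH₁-≅ {G = G} {H} {x} {y} {a} {b} {x′} {y′} {a′} {b′} g h
  with permutation-sending (IsH₁.distinct g) (IsH₁.distinct h) refl
... | σ , σx ∷ σy ∷ σa ∷ σb ∷ [] =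
  cover₂-≅ {G = G} {H} σ g.cover h.cover σx σy (trans h.xy (sym g.xy)) profile
  where
  module g = IsH₁ g
  module h = IsH₁ h
  profile : ∀ {s} → s ≢ x → s ≢ y → adj H (σ ⟨$⟩ʳ s) x′ ≡ adj G s x × adj H (σ ⟨$⟩ʳ s) y′ ≡ adj G s y
  profile {s} s≢x s≢y with s ≟F a | s ≟F b
  ... | yes refl | _        rewrite σa = trans h.ax (sym g.ax) , trans h.ay (sym g.ay)
  ... | no _     | yes refl rewrite σb = trans h.bx (sym g.bx) , trans h.by (sym g.by)
  ... | no s≢a   | no s≢b   =
    let σs = h.others (⟨$⟩ʳ-≢ σ s≢x σx) (⟨$⟩ʳ-≢ σ s≢y σy) (⟨$⟩ʳ-≢ σ s≢a σa) (⟨$⟩ʳ-≢ σ s≢b σb)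
        s∼ = g.others s≢x s≢y s≢a s≢b
    in trans (proj₁ σs) (sym (proj₁ s∼)) , trans (proj₂ σs) (sym (proj₂ s∼))

IsH₂-≅ : ∀ {n} {G H : Graph n} {x y a x′ y′ a′} → IsH₂ G x y a → IsH₂ H x′ y′ a′ → G ≅ H
IsH₂-≅ {G = G} {H} {x} {y} {a} {x′} {y′} {a′} g h
  with permutation-sending (IsH₂.distinct g) (IsH₂.distinct h) refl
... | σ , σx ∷ σy ∷ σa ∷ [] =
  cover₂-≅ {G = G} {H} σ g.cover h.cover σx σy (trans h.xy (sym g.xy)) profile
  where
  module g = IsH₂ g
  module h = IsH₂ h
  profile : ∀ {s} → s ≢ x → s ≢ y → adj H (σ ⟨$⟩ʳ s) x′ ≡ adj G s x × adj H (σ ⟨$⟩ʳ s) y′ ≡ adj G s y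
  profile {s} s≢x s≢y with s ≟F a
  ... | yes refl rewrite σa = trans h.ax (sym g.ax) , trans h.ay (sym g.ay)
  ... | no s≢a =
    let σs = h.others (⟨$⟩ʳ-≢ σ s≢x σx) (⟨$⟩ʳ-≢ σ s≢y σy) (⟨$⟩ʳ-≢ σ s≢a σa)
        s∼ = g.others s≢x s≢y s≢a
    in trans (proj₁ σs) (sym (proj₁ s∼)) , trans (proj₂ σs) (sym (proj₂ s∼))

module IsH₁-Properties {m} {G : Graph (5 + m)} {x y a b} (g : IsH₁ G x y a b) where
  open IsH₁ g
  open Walks G
  open Cover G cover
  private module C′ = Cover G (swap-cover {G = G} cover)

  attached : Attached
  attached {s} s≢x s≢y with s ≟F a | s ≟F b
  ... | yes refl | _        = inj₁ ax
  ... | no _     | yes refl = inj₂ by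
  ... | no s≢a   | no s≢b   = inj₁ (proj₁ (others s≢x s≢y s≢a s≢b))

  central-ecc : ∀ {v} → v ≢ a → v ≢ b → ecc G v ≤ 2
  central-ecc {v} v≢a v≢b = by-place (place x y v)
    where
    by-place : Place x y v → ecc G v ≤ 2
    by-place (is-x refl)        = ecc≤ (within₂ attached []ʷ (edge xy))
    by-place (is-y refl)        = ecc≤ (within₂ attached (edge (trans (adj-sym G _ _) xy)) []ʷ)
    by-place (elsewhere v≢x v≢y) =
      let vx , vy = others v≢x v≢y v≢a v≢b in ecc≤ (within₂ attached (edge vx) (edge vy))

  asc : AlmostSelfCentered G
  asc = almostSelfCentered a≢b (within₂ attached []ʷ (edge xy))
    (2≤radius (b , ≢-sym b≢x , trans (adj-sym G _ _) bx) (a , ≢-sym a≢y , trans (adj-sym G _ _) ay))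
    (pendant-far a≢x a≢y ay a≢b (cover a≢x a≢y b≢x b≢y) (trans (adj-sym G _ _) bx))
    (C′.pendant-far b≢y b≢x bx (≢-sym a≢b) (cover b≢x b≢y a≢x a≢y) (trans (adj-sym G _ _) ay))
    central-ecc

  independent-≤ : ∀ {T} → Independent G T → ∣ T ∣ + 2 ≤ 5 + m
  independent-≤ independent = disjointEdges⇒∣T∣+2≤n {G = G} independent
    (trans (adj-sym G _ _) ax) (trans (adj-sym G _ _) by) x≢y (≢-sym b≢x) a≢y a≢b

module IsH₂-Properties {m} {G : Graph (5 + m)} {x y a} (g : IsH₂ G x y a) where
  open IsH₂ g
  open Walks G
  open Cover G cover

  x∼ : Dominates x
  x∼ {s} s≢x s≢y with s ≟F a
  ... | yes refl = ax
  ... | no s≢a   = proj₁ (others s≢x s≢y s≢a)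

  attached : Attached
  attached s≢x s≢y = inj₁ (x∼ s≢x s≢y)

  c : Fin (5 + m)
  c = proj₁ (outsider a)

  c≢x : c ≢ x
  c≢x = proj₁ (proj₂ (outsider a))

  c≢y : c ≢ y
  c≢y = proj₁ (proj₂ (proj₂ (outsider a)))

  c≢a : c ≢ a
  c≢a = proj₂ (proj₂ (proj₂ (outsider a)))

  cx : adj G c x ≡ true
  cx = proj₁ (others c≢x c≢y c≢a)

  cy : adj G c y ≡ true
  cy = proj₂ (others c≢x c≢y c≢a)

  central-ecc : ∀ {v} → v ≢ a → v ≢ y → ecc G v ≤ 2
  central-ecc {v} v≢a v≢y = by-place (place x y v)
    where
    by-place : Place x y v → ecc G v ≤ 2
    by-place (is-x refl)        = ecc≤ (within₂′ x∼ (trans (adj-sym G _ _) cx ∷ʷ edge cy))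
    by-place (is-y refl)        = contradiction refl v≢y
    by-place (elsewhere v≢x v≢y) =
      let vx , vy = others v≢x v≢y v≢a in ecc≤ (within₂ attached (edge vx) (edge vy))

  asc : AlmostSelfCentered G
  asc = almostSelfCentered a≢y (within₂ attached (edge cx) (edge cy))
    (2≤radius (y , x≢y , xy) (x , ≢-sym x≢y , trans (adj-sym G _ _) xy))
    (pendant-far a≢x a≢y ay a≢y ay xy)
    (hub-far xy a≢x a≢y ay)
    central-ecc

  independent-≤ : ∀ {T} → Independent G T → ∣ T ∣ + 2 ≤ 5 + m
  independent-≤ independent = disjointEdges⇒∣T∣+2≤n {G = G} independent
    (trans (adj-sym G _ _) ax) (trans (adj-sym G _ _) cy) x≢y (≢-sym c≢x) a≢y (≢-sym c≢a)

-- The extremal graphs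

-- Vertex 0 plays x, vertex 1 plays y; x ∼ y iff e, and vertex 2 + s has neighbourhood profile p s in {x, y}.
coverGraph : ∀ {k} → Bool → (Fin k → Bool × Bool) → Graph (2 + k)
coverGraph {k} e p = record { adj = adjacent ; sym = symmetric ; irrefl = irreflexive }
  where
  adjacent : Fin (2 + k) → Fin (2 + k) → Bool
  adjacent zero          (suc zero)    = e
  adjacent zero          (suc (suc t)) = proj₁ (p t)
  adjacent (suc zero)    zero          = e
  adjacent (suc zero)    (suc (suc t)) = proj₂ (p t)
  adjacent (suc (suc s)) zero          = proj₁ (p s)
  adjacent (suc (suc s)) (suc zero)    = proj₂ (p s)
  adjacent _             _             = false
  symmetric : ∀ u v → adjacent u v ≡ adjacent v u
  symmetric zero          zero          = refl
  symmetric zero          (suc zero)    = refl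
  symmetric zero          (suc (suc _)) = refl
  symmetric (suc zero)    zero          = refl
  symmetric (suc zero)    (suc zero)    = refl
  symmetric (suc zero)    (suc (suc _)) = refl
  symmetric (suc (suc _)) zero          = refl
  symmetric (suc (suc _)) (suc zero)    = refl
  symmetric (suc (suc _)) (suc (suc _)) = refl
  irreflexive : ∀ u → adjacent u u ≡ false
  irreflexive zero          = refl
  irreflexive (suc zero)    = refl
  irreflexive (suc (suc _)) = refl

coverGraph-cover : ∀ {k} e (p : Fin k → Bool × Bool) → VertexCover₂ (coverGraph e p) zero (suc zero)
coverGraph-cover e p {zero}        {_}           u≢0 _   _   _   = contradiction refl u≢0
coverGraph-cover e p {suc zero}    {_}           _   u≢1 _   _   = contradiction refl u≢1
coverGraph-cover e p {suc (suc _)} {zero}        _   _   v≢0 _   = contradiction refl v≢0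
coverGraph-cover e p {suc (suc _)} {suc zero}    _   _   _   v≢1 = contradiction refl v≢1
coverGraph-cover e p {suc (suc _)} {suc (suc _)} _   _   _   _   = refl

hub? : ∀ {k} → Fin (2 + k) → Bool
hub? zero          = true
hub? (suc zero)    = true
hub? (suc (suc _)) = false

coverGraph-bipartite : ∀ {k} (p : Fin k → Bool × Bool) {u v} →
                       adj (coverGraph false p) u v ≡ true → hub? u ≢ hub? v
coverGraph-bipartite p {zero}        {suc (suc _)} _ ()
coverGraph-bipartite p {suc zero}    {suc (suc _)} _ ()
coverGraph-bipartite p {suc (suc _)} {zero}        _ ()
coverGraph-bipartite p {suc (suc _)} {suc zero}    _ ()

H₁ : ∀ m → Graph (5 + m)
H₁ m = coverGraph true profile
  where
  profile : Fin (3 + m) → Bool × Bool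
  profile zero       = true , false
  profile (suc zero) = false , true
  profile _          = true , true

H₂ : ∀ m → Graph (5 + m)
H₂ m = coverGraph false profile
  where
  profile : Fin (3 + m) → Bool × Bool
  profile zero = true , false
  profile _    = true , true

H₁-isH₁ : ∀ m → IsH₁ (H₁ m) zero (suc zero) (suc (suc zero)) (suc (suc (suc zero)))
H₁-isH₁ m = record
  { x≢y = λ () ; a≢x = λ () ; a≢y = λ () ; b≢x = λ () ; b≢y = λ () ; a≢b = λ ()
  ; cover = coverGraph-cover _ _
  ; xy = refl ; ax = refl ; ay = refl ; bx = refl ; by = refl
  ; others = others
  }
  where
  others : ∀ {s} → s ≢ zero → s ≢ suc zero → s ≢ suc (suc zero) → s ≢ suc (suc (suc zero)) →
           adj (H₁ m) s zero ≡ true × adj (H₁ m) s (suc zero) ≡ true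
  others {zero}                      s≢x _ _ _ = contradiction refl s≢x
  others {suc zero}                  _ s≢y _ _ = contradiction refl s≢y
  others {suc (suc zero)}            _ _ s≢a _ = contradiction refl s≢a
  others {suc (suc (suc zero))}      _ _ _ s≢b = contradiction refl s≢b
  others {suc (suc (suc (suc _)))}   _ _ _ _   = refl , refl

H₂-isH₂ : ∀ m → IsH₂ (H₂ m) zero (suc zero) (suc (suc zero))
H₂-isH₂ m = record
  { x≢y = λ () ; a≢x = λ () ; a≢y = λ ()
  ; cover = coverGraph-cover _ _
  ; xy = refl ; ax = refl ; ay = refl
  ; others = others
  }
  where
  others : ∀ {s} → s ≢ zero → s ≢ suc zero → s ≢ suc (suc zero) →
           adj (H₂ m) s zero ≡ true × adj (H₂ m) s (suc zero) ≡ true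
  others {zero}              s≢x _ _ = contradiction refl s≢x
  others {suc zero}          _ s≢y _ = contradiction refl s≢y
  others {suc (suc zero)}    _ _ s≢a = contradiction refl s≢a
  others {suc (suc (suc _))} _ _ _   = refl , refl

¬distinct₃ : ∀ {a b c : Bool} → a ≢ b → a ≢ c → b ≢ c → ⊥
¬distinct₃ a≢b a≢c b≢c = b≢c (not-injective (trans (sym (¬-not a≢b)) (¬-not a≢c)))

-- H₁ contains the triangle x y z, while H₂ is bipartite.
H₁≇H₂ : ∀ m → ¬ (H₁ m ≅ H₂ m)
H₁≇H₂ m (σ , preserves) = ¬distinct₃ (hub≢ x y refl) (hub≢ x z refl) (hub≢ y z refl)
  where
  x y z : Fin (5 + m)
  x = zero
  y = suc zero
  z = suc (suc (suc (suc zero)))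
  hub≢ : ∀ u v → adj (H₁ m) u v ≡ true → hub? (σ ⟨$⟩ʳ u) ≢ hub? (σ ⟨$⟩ʳ v)
  hub≢ u v uv = coverGraph-bipartite _ (trans (preserves u v) uv)

-- Classification

module ASC-Cover {m} (G : Graph (5 + m)) (connected : Connected G) (two : TwoNonCentral G)
                      {x y} (x≢y : x ≢ y) (cover : VertexCover₂ G x y) where
  open TwoNonCentral two
  open Walks G
  open Cover G cover public

  attached : Attached
  attached = connected⇒attached connected

  dominates? : ∀ z → Misses z ⊎ Dominates z
  dominates? z with any? (λ s → ¬? (s ≟F x) ×-dec ¬? (s ≟F y) ×-dec (adj G s z Data.Bool.≟ false))
  ... | yes (s , s≢x , s≢y , ¬sz) = inj₁ (s , s≢x , s≢y , ¬sz)
  ... | no  none                   = inj₂ λ s≢x s≢y → ¬-not λ ¬sz → none (_ , s≢x , s≢y , ¬sz)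

  -- If x dominates G then radius G ≤ 1, but only x and y have eccentricity 1.
  ¬dominating : adj G x y ≡ true → ¬ Dominates x
  ¬dominating xy x∼ = ¬central⊆ {x} {y} central⊆xy
    where
    radius≤1 : radius G ≤ 1
    radius≤1 = ≤-trans (radius≤ecc x) (ecc≤ λ v → by-place v (place x y v))
      where
      by-place : ∀ v → Place x y v → Walk 1 x v
      by-place v (is-x refl)        = []ʷ
      by-place v (is-y refl)        = edge xy
      by-place v (elsewhere v≢x v≢y) = edge (trans (adj-sym G _ _) (x∼ v≢x v≢y))
    central⊆xy : ∀ v → Central G v → v ≡ x ⊎ v ≡ y
    central⊆xy v central = by-place (place x y v)
      where
      by-place : Place x y v → v ≡ x ⊎ v ≡ y
      by-place (is-x v≡x)          = inj₁ v≡x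
      by-place (is-y v≡y)          = inj₂ v≡y
      by-place (elsewhere v≢x v≢y) =
        let w , w≢x , w≢y , w≢v = outsider v
        in contradiction (≤-trans (≤-reflexive central) radius≤1)
                         (<⇒≱ (1<ecc (s≤s (s≤s z≤n)) (≢-sym w≢v) (cover v≢x v≢y w≢x w≢y)))

  commonNeighbour : adj G x y ≡ false → ∃ λ c → c ≢ x × c ≢ y × adj G c x ≡ true × adj G c y ≡ true
  commonNeighbour ¬xy
    with any? (λ s → ¬? (s ≟F x) ×-dec ¬? (s ≟F y) ×-dec (adj G s x Data.Bool.≟ true) ×-dec (adj G s y Data.Bool.≟ true))
  ... | yes found = found
  ... | no  none  =
    contradiction refl (proj₁ (Walk-closed Z step (proj₂ (Connected⇒Walk connected x y)) (x≢y , ¬xy)))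
    where
    Z : Fin (5 + m) → Set
    Z u = u ≢ y × adj G u y ≡ false
    step : ∀ {u w} → Z u → adj G u w ≡ true → Z w
    step {u} {w} (u≢y , ¬uy) uw with u ≟F x
    ... | yes refl = w≢y , ¬-not λ wy → none (w , w≢x , w≢y , trans (adj-sym G _ _) uw , wy)
      where
      w≢x : w ≢ x
      w≢x refl = contradiction (trans (sym (irrefl G x)) uw) λ ()
      w≢y : w ≢ y
      w≢y refl = contradiction (trans (sym ¬xy) uw) λ ()
    ... | no u≢x with neighbour∈cover u≢x u≢y uw
    ...   | inj₁ refl = x≢y , ¬xy
    ...   | inj₂ refl = contradiction (trans (sym ¬uy) uw) λ ()

  radius≤2 : ∀ {u} → Walk 1 u x → Walk 1 u y → radius G ≤ 2
  radius≤2 {u} ux uy = ≤-trans (radius≤ecc u) (ecc≤ (within₂ attached ux uy))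

  pendant-noncentral : radius G ≤ 2 → ∀ {s t} → s ≢ x → s ≢ y → adj G s y ≡ false →
                       t ≢ x → t ≢ y → adj G t x ≡ false → ¬ Central G s
  pendant-noncentral r≤2 {s} {t} s≢x s≢y ¬sy t≢x t≢y ¬tx = far⇒noncentral G s r≤2
    (pendant-far s≢x s≢y ¬sy s≢t (cover s≢x s≢y t≢x t≢y) (trans (adj-sym G _ _) ¬tx))
    where
    s≢t : s ≢ t
    s≢t refl = contradiction (≁y⇒∼x attached s≢x s≢y ¬sy) λ sx → contradiction (trans (sym ¬tx) sx) λ ()

  oneSided : adj G x y ≡ false → radius G ≤ 2 → ∀ {a} → a ≢ x → a ≢ y → adj G a y ≡ false →
             Dominates x → IsH₂ G x y a
  oneSided ¬xy r≤2 {a} a≢x a≢y ¬ay x∼ = record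
    { x≢y = x≢y ; a≢x = a≢x ; a≢y = a≢y ; cover = cover ; xy = ¬xy ; ax = x∼ a≢x a≢y ; ay = ¬ay
    ; others = λ s≢x s≢y s≢a → x∼ s≢x s≢y , y∼ s≢x s≢y s≢a }
    where
    noncentral : ∀ {s} → s ≢ x → s ≢ y → adj G s y ≡ false → ¬ Central G s
    noncentral {s} s≢x s≢y ¬sy = far⇒noncentral G s r≤2 (pendant-far s≢x s≢y ¬sy s≢y ¬sy ¬xy)
    y∼ : ∀ {s} → s ≢ x → s ≢ y → s ≢ a → adj G s y ≡ true
    y∼ {s} s≢x s≢y s≢a = ¬-not λ ¬sy → ¬noncentral₃ (≢-sym s≢a) a≢y s≢y
      (noncentral a≢x a≢y ¬ay) (noncentral s≢x s≢y ¬sy) (far⇒noncentral G y r≤2 (hub-far ¬xy a≢x a≢y ¬ay))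

Shape : ∀ {n} → Graph n → Set
Shape G = (∃₂ λ x y → ∃₂ λ a b → IsH₁ G x y a b) ⊎ (∃₂ λ x y → ∃ λ a → IsH₂ G x y a)

module Classify {m} (G : Graph (5 + m)) (connected : Connected G) (two : TwoNonCentral G)
                {x y} (x≢y : x ≢ y) (cover : VertexCover₂ G x y) where
  open TwoNonCentral two
  open Walks G
  private
    module X = ASC-Cover G connected two x≢y cover
    module Y = ASC-Cover G connected two (≢-sym x≢y) (swap-cover {G = G} cover)

  adjacentCase : adj G x y ≡ true → ∃₂ λ a b → IsH₁ G x y a b
  adjacentCase xy with X.dominates? x | X.dominates? y
  ... | inj₂ x∼ | _      = ⊥-elim (X.¬dominating xy x∼)
  ... | inj₁ _  | inj₂ y∼ = ⊥-elim (Y.¬dominating (trans (adj-sym G _ _) xy) λ s≢y s≢x → y∼ s≢x s≢y)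
  ... | inj₁ (b , b≢x , b≢y , ¬bx) | inj₁ (a , a≢x , a≢y , ¬ay) = a , b , record
    { x≢y = x≢y ; a≢x = a≢x ; a≢y = a≢y ; b≢x = b≢x ; b≢y = b≢y ; a≢b = a≢b ; cover = cover
    ; xy = xy ; ax = ax ; ay = ¬ay ; bx = ¬bx ; by = Y.≁y⇒∼x Y.attached b≢y b≢x ¬bx ; others = others }
    where
    r≤2 : radius G ≤ 2
    r≤2 = X.radius≤2 []ʷ (edge xy)
    ax : adj G a x ≡ true
    ax = X.≁y⇒∼x X.attached a≢x a≢y ¬ay
    a≢b : a ≢ b
    a≢b refl = contradiction (trans (sym ¬bx) ax) λ ()
    ¬a : ¬ Central G a
    ¬a = X.pendant-noncentral r≤2 a≢x a≢y ¬ay b≢x b≢y ¬bx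
    ¬b : ¬ Central G b
    ¬b = Y.pendant-noncentral r≤2 b≢y b≢x ¬bx a≢y a≢x ¬ay
    others : ∀ {s} → s ≢ x → s ≢ y → s ≢ a → s ≢ b → adj G s x ≡ true × adj G s y ≡ true
    others {s} s≢x s≢y s≢a s≢b =
      ¬-not (λ ¬sx → third (Y.pendant-noncentral r≤2 s≢y s≢x ¬sx a≢y a≢x ¬ay)) ,
      ¬-not (λ ¬sy → third (X.pendant-noncentral r≤2 s≢x s≢y ¬sy b≢x b≢y ¬bx))
      where
      third : ¬ ¬ Central G s
      third = ¬noncentral₃ a≢b (≢-sym s≢a) (≢-sym s≢b) ¬a ¬b

  nonadjacentCase : adj G x y ≡ false → (∃ λ a → IsH₂ G x y a) ⊎ (∃ λ b → IsH₂ G y x b)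
  nonadjacentCase ¬xy with X.commonNeighbour ¬xy
  ... | c , c≢x , c≢y , cx , cy = by-cases (X.dominates? x) (X.dominates? y)
    where
    ¬yx : adj G y x ≡ false
    ¬yx = trans (adj-sym G _ _) ¬xy
    r≤2 : radius G ≤ 2
    r≤2 = X.radius≤2 (edge cx) (edge cy)
    by-cases : X.Misses x ⊎ X.Dominates x → X.Misses y ⊎ X.Dominates y →
               (∃ λ a → IsH₂ G x y a) ⊎ (∃ λ b → IsH₂ G y x b)
    by-cases (inj₁ (b , b≢x , b≢y , ¬bx)) (inj₁ (a , a≢x , a≢y , ¬ay)) =
      contradiction (far⇒noncentral G x r≤2 (Y.hub-far ¬yx b≢y b≢x ¬bx))
        (¬noncentral₃ a≢b a≢x b≢x (X.pendant-noncentral r≤2 a≢x a≢y ¬ay b≢x b≢y ¬bx)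
                                  (Y.pendant-noncentral r≤2 b≢y b≢x ¬bx a≢y a≢x ¬ay))
      where
      a≢b : a ≢ b
      a≢b refl = contradiction (trans (sym ¬bx) (X.≁y⇒∼x X.attached a≢x a≢y ¬ay)) λ ()
    by-cases (inj₂ x∼) (inj₁ (a , a≢x , a≢y , ¬ay)) = inj₁ (a , X.oneSided ¬xy r≤2 a≢x a≢y ¬ay x∼)
    by-cases (inj₁ (b , b≢x , b≢y , ¬bx)) (inj₂ y∼) =
      inj₂ (b , Y.oneSided ¬yx r≤2 b≢y b≢x ¬bx λ s≢y s≢x → y∼ s≢x s≢y)
    by-cases (inj₂ x∼) (inj₂ y∼) = ⊥-elim (¬allCentral central)
      where
      central : ∀ v → Central G v
      central v = ≤-antisym (≤-trans (ecc≤2 (place x y v)) 2≤radius) (radius≤ecc v)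
        where
        2≤radius : 2 ≤ radius G
        2≤radius = X.2≤radius (y , x≢y , ¬xy) (x , ≢-sym x≢y , ¬yx)
        ecc≤2 : Place x y v → ecc G v ≤ 2
        ecc≤2 (is-x refl)        = ecc≤ (X.within₂′ x∼ (trans (adj-sym G _ _) cx ∷ʷ edge cy))
        ecc≤2 (is-y refl)        = ecc≤ (Y.within₂′ (λ s≢y s≢x → y∼ s≢x s≢y) (trans (adj-sym G _ _) cy ∷ʷ edge cx))
        ecc≤2 (elsewhere v≢x v≢y) = ecc≤ (X.within₂ X.attached (edge (x∼ v≢x v≢y)) (edge (y∼ v≢x v≢y)))

classify : ∀ {m} (G : Graph (5 + m)) → Connected G → TwoNonCentral G →
           ∀ {x y} → x ≢ y → VertexCover₂ G x y → Shape G
classify G connected two {x} {y} x≢y cover = by-adjacency (adj G x y) refl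
  where
  open Classify G connected two x≢y cover
  by-adjacency : ∀ e → adj G x y ≡ e → Shape G
  by-adjacency true  xy  = inj₁ (x , y , adjacentCase xy)
  by-adjacency false ¬xy =
    inj₂ (Data.Sum.[ (λ (a , h) → x , y , a , h) , (λ (b , h) → y , x , b , h) ]′ (nonadjacentCase ¬xy))

module _ {m : ℕ} where

  shapeOf : ∀ {G : Graph (5 + m)} {T} → AlmostSelfCentered G → Independent G T → 5 + m ≤ ∣ T ∣ + 2 → Shape G
  shapeOf {G} (connected , central≡) independent large =
    fromCover (largeIndependent⇒cover {G = G} (s≤s (s≤s z≤n)) independent large)
    where
    fromCover : (∃₂ λ x y → x ≢ y × VertexCover₂ G x y) → Shape G
    fromCover (x , y , x≢y , cover) = classify G connected (twoNonCentral central≡) x≢y cover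

  +2≤5+m⇒≤3+m : ∀ {k} → k + 2 ≤ 5 + m → k ≤ 3 + m
  +2≤5+m⇒≤3+m {k} k+2≤ = +-cancelʳ-≤ 2 k (3 + m) (subst (k + 2 ≤_) (+-comm 2 (3 + m)) k+2≤)

  Shape⇒∣T∣≤ : ∀ {G : Graph (5 + m)} {T} → Shape G → Independent G T → ∣ T ∣ ≤ 3 + m
  Shape⇒∣T∣≤ (inj₁ (_ , _ , _ , _ , h)) = +2≤5+m⇒≤3+m ∘ IsH₁-Properties.independent-≤ h
  Shape⇒∣T∣≤ (inj₂ (_ , _ , _ , h))     = +2≤5+m⇒≤3+m ∘ IsH₂-Properties.independent-≤ h

  Shape⇒≅ : ∀ {G : Graph (5 + m)} → Shape G → G ≅ H₁ m ⊎ G ≅ H₂ m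
  Shape⇒≅ (inj₁ (_ , _ , _ , _ , h)) = inj₁ (IsH₁-≅ h (H₁-isH₁ m))
  Shape⇒≅ (inj₂ (_ , _ , _ , h))     = inj₂ (IsH₂-≅ h (H₂-isH₂ m))

  nonHubs : Subset (5 + m)
  nonHubs = outside ∷ outside ∷ ⊤

  coverGraph-independenceNumber : ∀ e p → (∀ T → Independent (coverGraph e p) T → ∣ T ∣ ≤ 3 + m) →
                                  IndependenceNumber (coverGraph e p) (3 + m)
  coverGraph-independenceNumber e p bound = (nonHubs , independent , ∣⊤∣≡n (3 + m)) , bound
    where
    not-hub : ∀ {i} → i ∈ₛ nonHubs → i ≢ zero × i ≢ suc zero
    not-hub {suc zero}    (thereᵥ ())
    not-hub {suc (suc _)} _          = (λ ()) , (λ ())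
    independent : Independent (coverGraph e p) nonHubs
    independent i j i∈ j∈ =
      let i≢x , i≢y = not-hub i∈ ; j≢x , j≢y = not-hub j∈ in coverGraph-cover e p i≢x i≢y j≢x j≢y

  H₁-independenceNumber : IndependenceNumber (H₁ m) (3 + m)
  H₁-independenceNumber =
    coverGraph-independenceNumber _ _ λ T → Shape⇒∣T∣≤ (inj₁ (_ , _ , _ , _ , H₁-isH₁ m))

  H₂-independenceNumber : IndependenceNumber (H₂ m) (3 + m)
  H₂-independenceNumber =
    coverGraph-independenceNumber _ _ λ T → Shape⇒∣T∣≤ (inj₂ (_ , _ , _ , H₂-isH₂ m))

  independenceNumber≤ : ∀ (G : Graph (5 + m)) → AlmostSelfCentered G → ∀ a → IndependenceNumber G a → a ≤ 3 + m
  independenceNumber≤ G asc _ ((T , independent , refl) , _) = by-size (5 + m ≤? ∣ T ∣ + 2)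
    where
    by-size : Dec (5 + m ≤ ∣ T ∣ + 2) → ∣ T ∣ ≤ 3 + m
    by-size (yes large) = Shape⇒∣T∣≤ (shapeOf asc independent large) independent
    by-size (no  small) = +2≤5+m⇒≤3+m (<⇒≤ (≰⇒> small))

  extremal : ∀ (G : Graph (5 + m)) → AlmostSelfCentered G → IndependenceNumber G (3 + m) → G ≅ H₁ m ⊎ G ≅ H₂ m
  extremal G asc ((T , independent , ∣T∣≡) , _) =
    Shape⇒≅ (shapeOf asc independent (≤-reflexive (trans (+-comm 2 (3 + m)) (cong (_+ 2) (sym ∣T∣≡)))))

corollary7 : (n : ℕ) → 5 ≤ n →
    ((∀ (G : Graph n) → AlmostSelfCentered G → ∀ a → IndependenceNumber G a → a ≤ n ∸ 2) ×
     Σ (Graph n) (λ G → AlmostSelfCentered G × IndependenceNumber G (n ∸ 2))) ×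
    Σ (Graph n) (λ G₁ → Σ (Graph n) (λ G₂ →
      AlmostSelfCentered G₁ × IndependenceNumber G₁ (n ∸ 2) ×
      AlmostSelfCentered G₂ × IndependenceNumber G₂ (n ∸ 2) ×
      ¬ (G₁ ≅ G₂) ×
      (∀ (G : Graph n) → AlmostSelfCentered G → IndependenceNumber G (n ∸ 2) →
        (G ≅ G₁) ⊎ (G ≅ G₂))))
corollary7 (suc (suc (suc (suc (suc m))))) (s≤s (s≤s (s≤s (s≤s (s≤s z≤n))))) =
  (independenceNumber≤ , H₁ m , H₁-asc , H₁-independenceNumber) ,
  H₁ m , H₂ m , H₁-asc , H₁-independenceNumber , H₂-asc , H₂-independenceNumber , H₁≇H₂ m , extremal
  where
  H₁-asc : AlmostSelfCentered (H₁ m)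
  H₁-asc = IsH₁-Properties.asc (H₁-isH₁ m)
  H₂-asc : AlmostSelfCentered (H₂ m)
  H₂-asc = IsH₂-Properties.asc (H₂-isH₂ m)
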